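{- Let $\ell>0$ and $b\neq0$ be integers with $\ell^2+4b\geq0$, let $\mathbf{s}$ be defined by $s_0=0$, $s_1=1$, $s_j=\ell s_{j-1}+bs_{j-2}$ for $j\geq2$, and let $r=\gcd(\ell,b)$, $t=\gcd(\ell^2/r,\,b/r)$, $\sigma=r/t$. Define $h_n=\dfrac{s_n}{t^{n-1}\sigma^{\lfloor n/2\rfloor}}$ for $n\geq1$. Then for every $B>0$ there is a positive integer $n_0$ such that $h_n>B$ for all $n\geq n_0$. -}

module Defs where

open import Data.Nat as ℕ using (ℕ; zero; suc)
open import Data.Nat.GCD using (gcd)
open import Data.Integer as ℤ using (ℤ; +_)
open import Data.Rational.Unnormalised as ℚᵘ using (ℚᵘ; mkℚᵘ; 0ℚᵘ)

s : ℤ → ℤ → ℕ → ℤ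
s ℓ b zero = + 0
s ℓ b (suc zero) = + 1
s ℓ b (suc (suc j)) = ℓ ℤ.* s ℓ b (suc j) ℤ.+ b ℤ.* s ℓ b j

-- Exact natural-number division (all divisions below are exact and by
-- nonzero numbers under the hypotheses; the zero-divisor clause is never used).
_div_ : ℕ → ℕ → ℕ
m div zero = 0
m div (suc d) = ℕ._/_ m (suc d)

r : ℕ → ℤ → ℕ
r ℓ b = gcd ℓ (ℤ.∣ b ∣)

t : ℕ → ℤ → ℕ
t ℓ b = gcd ((ℓ ℕ.* ℓ) div r ℓ b) (ℤ.∣ b ∣ div r ℓ b)

σ : ℕ → ℤ → ℕ
σ ℓ b = r ℓ b div t ℓ b

den : ℕ → ℤ → ℕ → ℕ
den ℓ b n = (t ℓ b ℕ.^ (n ℕ.∸ 1)) ℕ.* (σ ℓ b ℕ.^ (n ℕ./ 2))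

-- Rational number z / d (d > 0 under the hypotheses; d = 0 clause unused).
_÷_ : ℤ → ℕ → ℚᵘ
z ÷ zero = 0ℚᵘ
z ÷ suc d = mkℚᵘ z d

h : ℕ → ℤ → ℕ → ℚᵘ
h ℓ b n = s (+ ℓ) b n ÷ den ℓ b n

module Submission where

-- Proof idea.  Write c = |b| and D_n = t^(n-1) σ^⌊n/2⌋, so h_n = s_n / D_n.
--
-- With r = gcd(ℓ, c), ℓ = ℓ′r and
--   c = b′r (ℓ′, b′ coprime), t divides b′ and is coprime to ℓ′, hence t ∣ r.
--   So σ is an exact quotient, t, σ ≥ 1 and t²σ = t·r ≤ c; therefore
--   D_n² ≤ cⁿ.
-- * Numerators (s-grows).  s is natural-valued and c^k (k+1) ≤ s_{k+3}²
--   (the predicate Growth).  For b > 0 this follows from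
--   s_{n+1} s_{n+2} ≥ (1+c)ⁿ and a Bernoulli inequality.  For b < 0 the
--   discriminant Δ = ℓ² − 4c is ≥ 0 and the companion sequence
--   e_n = 2 s_{n+1} − ℓ s_n satisfies e_n² = Δ s_n² + 4cⁿ (a form of
--   Cassini's identity); squaring 2 s_{n+1} = ℓ s_n + e_n then gives
--   n² cⁿ ≤ c s_n², the growth of the double-root case.
-- * Conclusion.  For B = p/q, h_n² ≥ s_n²/cⁿ ≥ (n−2)/c³, so h_n > B as soon
--   as n ≥ 3 + p² c³.

open import Defs
open import Data.Nat as ℕ using (ℕ)
open import Data.Integer as ℤ using (ℤ; +_)
open import Data.Rational.Unnormalised as ℚᵘ using (ℚᵘ; 0ℚᵘ)
open import Data.Product using (Σ; _×_)
open import Relation.Binary.PropositionalEquality using (_≢_)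

open import Data.Nat
open import Data.Nat.Properties
open import Data.Nat.Divisibility using (_∣_; ∣-trans; ∣-refl; *-pres-∣; ∣⇒≤)
open import Data.Nat.DivMod using (_/_; m/n*n≡m; m/n*n≤m; *-/-assoc)
open import Data.Nat.GCD using (gcd; gcd[m,n]∣m; gcd[m,n]∣n; gcd[m,n]≢0; n/gcd[m,n]≢0)
open import Data.Nat.Coprimality using (Coprime; coprime-/gcd; coprime-divisor)
open import Data.Nat.Tactic.RingSolver using (solve-∀)
open import Data.Integer using (-[1+_])
import Data.Integer.Properties as ℤP
import Data.Integer.Tactic.RingSolver as ℤSolver
open import Data.Rational.Unnormalised using (mkℚᵘ; *<*)
open import Data.Product using (_,_; proj₁; proj₂)
open import Data.Sum using (inj₂)
open import Relation.Binary.PropositionalEquality using (_≡_; refl; sym; trans; cong; cong₂; subst; subst₂; module ≡-Reasoning)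
open import Relation.Nullary using (yes; no; contradiction)

div≡/ : ∀ m d .{{_ : NonZero d}} → m div d ≡ m / d
div≡/ m (suc d) = refl

∣b∣-nonZero : ∀ {b} → b ≢ + 0 → NonZero ℤ.∣ b ∣
∣b∣-nonZero b≢0 = ≢-nonZero λ ∣b∣≡0 → b≢0 (ℤP.∣i∣≡0⇒i≡0 ∣b∣≡0)

^-distribʳ-* : ∀ x y n → (x * y) ^ n ≡ x ^ n * y ^ n
^-distribʳ-* x y zero = refl
^-distribʳ-* x y (suc n) = trans (cong (x * y *_) (^-distribʳ-* x y n)) (interchange x y (x ^ n) (y ^ n))
  where
  interchange : ∀ a b p q → a * b * (p * q) ≡ a * p * (b * q)
  interchange = solve-∀

1≤^ : ∀ x n → 1 ≤ x → 1 ≤ x ^ n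
1≤^ x n 1≤x = subst (_≤ x ^ n) (^-zeroˡ n) (^-monoˡ-≤ n 1≤x)

square-≤⇒≤ : ∀ x y → x * x ≤ y * y → x ≤ y
square-≤⇒≤ x y x²≤y² with x ≤? y
... | yes x≤y = x≤y
... | no x≰y = contradiction x²≤y² (<⇒≱ (*-mono-< (≰⇒> x≰y) (≰⇒> x≰y)))

square-<⇒< : ∀ x y → x * x < y * y → x < y
square-<⇒< x y x²<y² with x <? y
... | yes x<y = x<y
... | no x≮y = contradiction x²<y² (≤⇒≯ (*-mono-≤ (≮⇒≥ x≮y) (≮⇒≥ x≮y)))

+-linear : ∀ a p b q → + a ℤ.* + p ℤ.+ + b ℤ.* + q ≡ + (a * p + b * q)
+-linear a p b q = sym (trans (ℤP.pos-+ (a * p) (b * q)) (cong₂ ℤ._+_ (ℤP.pos-* a p) (ℤP.pos-* b q)))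

+-^ : ∀ c n → (+ c) ℤ.^ n ≡ + (c ^ n)
+-^ c zero = refl
+-^ c (suc n) = trans (cong (+ c ℤ.*_) (+-^ c n)) (sym (ℤP.pos-* c (c ^ n)))

-- Writing
-- ℓ = ℓ′r and |b| = b′r with ℓ′, b′ coprime, t divides b′ and ℓ²/r = ℓ′²r;
-- being coprime to ℓ′, t divides r.  Hence σ is an exact quotient, t, σ ≥ 1,
-- and t²σ = t·r divides b′r = |b|.
module ReducedGcd (ℓ : ℕ) (b : ℤ) (b≢0 : b ≢ + 0) where

  private
    c : ℕ
    c = ℤ.∣ b ∣

    instance
      c≢0 : NonZero c
      c≢0 = ∣b∣-nonZero b≢0

    r≢0 : r ℓ b ≢ 0
    r≢0 = gcd[m,n]≢0 ℓ c (inj₂ (≢-nonZero⁻¹ c))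

    instance
      r-nonZero : NonZero (r ℓ b)
      r-nonZero = ≢-nonZero r≢0

    ℓ′ b′ : ℕ
    ℓ′ = ℓ / r ℓ b
    b′ = c / r ℓ b

    ℓ′-coprime-b′ : Coprime ℓ′ b′
    ℓ′-coprime-b′ = coprime-/gcd ℓ c

    ℓ′r≡ℓ : ℓ′ * r ℓ b ≡ ℓ
    ℓ′r≡ℓ = m/n*n≡m (gcd[m,n]∣m ℓ c)

    b′r≡c : b′ * r ℓ b ≡ c
    b′r≡c = m/n*n≡m (gcd[m,n]∣n ℓ c)

    ℓ²/r≡ℓ′ℓ′r : (ℓ * ℓ) div r ℓ b ≡ ℓ′ * (ℓ′ * r ℓ b)
    ℓ²/r≡ℓ′ℓ′r = begin
      (ℓ * ℓ) div r ℓ b    ≡⟨ div≡/ (ℓ * ℓ) (r ℓ b) ⟩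
      ℓ * ℓ / r ℓ b        ≡⟨ *-/-assoc ℓ (gcd[m,n]∣m ℓ c) ⟩
      ℓ * ℓ′               ≡⟨ cong (_* ℓ′) (sym ℓ′r≡ℓ) ⟩
      ℓ′ * r ℓ b * ℓ′      ≡⟨ rearrange ℓ′ (r ℓ b) ⟩
      ℓ′ * (ℓ′ * r ℓ b)    ∎
      where
      open ≡-Reasoning
      rearrange : ∀ x y → x * y * x ≡ x * (x * y)
      rearrange = solve-∀

    t∣b′ : t ℓ b ∣ b′
    t∣b′ = subst (t ℓ b ∣_) (div≡/ c (r ℓ b)) (gcd[m,n]∣n ((ℓ * ℓ) div r ℓ b) (c div r ℓ b))

    t∣ℓ′ℓ′r : t ℓ b ∣ ℓ′ * (ℓ′ * r ℓ b)
    t∣ℓ′ℓ′r = subst (t ℓ b ∣_) ℓ²/r≡ℓ′ℓ′r (gcd[m,n]∣m ((ℓ * ℓ) div r ℓ b) (c div r ℓ b))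

    t-coprime-ℓ′ : Coprime (t ℓ b) ℓ′
    t-coprime-ℓ′ (d∣t , d∣ℓ′) = ℓ′-coprime-b′ (d∣ℓ′ , ∣-trans d∣t t∣b′)

    t∣r : t ℓ b ∣ r ℓ b
    t∣r = coprime-divisor t-coprime-ℓ′ (coprime-divisor t-coprime-ℓ′ t∣ℓ′ℓ′r)

    -- t ≠ 0 because b′ ≠ 0.
    t≢0 : t ℓ b ≢ 0
    t≢0 = gcd[m,n]≢0 ((ℓ * ℓ) div r ℓ b) (c div r ℓ b)
            (inj₂ (subst (_≢ 0) (sym (div≡/ c (r ℓ b))) (n/gcd[m,n]≢0 ℓ c)))

    instance
      t-nonZero : NonZero (t ℓ b)
      t-nonZero = ≢-nonZero t≢0

    σt≡r : σ ℓ b * t ℓ b ≡ r ℓ b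
    σt≡r = trans (cong (_* t ℓ b) (div≡/ (r ℓ b) (t ℓ b))) (m/n*n≡m t∣r)

  1≤t : 1 ≤ t ℓ b
  1≤t = >-nonZero⁻¹ (t ℓ b)

  1≤σ : 1 ≤ σ ℓ b
  1≤σ = n≢0⇒n>0 (λ σ≡0 → r≢0 (trans (sym σt≡r) (cong (_* t ℓ b) σ≡0)))

  t²σ≤∣b∣ : t ℓ b * t ℓ b * σ ℓ b ≤ c
  t²σ≤∣b∣ = begin
    t ℓ b * t ℓ b * σ ℓ b     ≡⟨ rearrange (t ℓ b) (σ ℓ b) ⟩
    t ℓ b * (σ ℓ b * t ℓ b)   ≡⟨ cong (t ℓ b *_) σt≡r ⟩
    t ℓ b * r ℓ b             ≤⟨ ∣⇒≤ (subst (t ℓ b * r ℓ b ∣_) b′r≡c (*-pres-∣ t∣b′ ∣-refl)) ⟩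
    c                         ∎
    where
    open ≤-Reasoning
    rearrange : ∀ x y → x * x * y ≡ x * (y * x)
    rearrange = solve-∀

den-pos : ∀ τ ς n → 1 ≤ τ → 1 ≤ ς → 1 ≤ τ ^ (n ∸ 1) * ς ^ (n / 2)
den-pos τ ς n 1≤τ 1≤ς = *-mono-≤ (1≤^ τ (n ∸ 1) 1≤τ) (1≤^ ς (n / 2) 1≤ς)

den²≤^ : ∀ τ ς c n → 1 ≤ τ → 1 ≤ ς → τ * τ * ς ≤ c →
         τ ^ (n ∸ 1) * ς ^ (n / 2) * (τ ^ (n ∸ 1) * ς ^ (n / 2)) ≤ c ^ n
den²≤^ τ ς c n 1≤τ 1≤ς τ²ς≤c = begin
  τ ^ a * ς ^ m * (τ ^ a * ς ^ m)   ≡⟨ interchange (τ ^ a) (ς ^ m) ⟩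
  τ ^ a * τ ^ a * (ς ^ m * ς ^ m)   ≡⟨ cong (τ ^ a * τ ^ a *_) (sym (^-distribˡ-+-* ς m m)) ⟩
  τ ^ a * τ ^ a * ς ^ (m + m)       ≤⟨ *-mono-≤ (*-mono-≤ τ^a≤τ^n τ^a≤τ^n) (^-monoʳ-≤ ς m+m≤n) ⟩
  τ ^ n * τ ^ n * ς ^ n             ≡⟨ sym (trans (^-distribʳ-* (τ * τ) ς n) (cong (_* ς ^ n) (^-distribʳ-* τ τ n))) ⟩
  (τ * τ * ς) ^ n                   ≤⟨ ^-monoˡ-≤ n τ²ς≤c ⟩
  c ^ n                             ∎
  where
  open ≤-Reasoning
  instance
    τ-nonZero : NonZero τ
    τ-nonZero = >-nonZero 1≤τ
    ς-nonZero : NonZero ς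
    ς-nonZero = >-nonZero 1≤ς
  a m : ℕ
  a = n ∸ 1
  m = n / 2
  τ^a≤τ^n : τ ^ a ≤ τ ^ n
  τ^a≤τ^n = ^-monoʳ-≤ τ (m∸n≤m n 1)
  double : ∀ x → x * 2 ≡ x + x
  double = solve-∀
  m+m≤n : m + m ≤ n
  m+m≤n = subst (_≤ n) (double m) (m/n*n≤m n 2)
  interchange : ∀ x y → x * y * (x * y) ≡ x * x * (y * y)
  interchange = solve-∀

Growth : ℕ → (ℕ → ℕ) → Set
Growth c S = ∀ k → c ^ k * suc k ≤ S (3 + k) * S (3 + k)

bernoulli : ∀ c k → c ^ k * (c + suc k) ≤ suc c ^ suc k
bernoulli c zero = ≤-reflexive (base c)
  where
  base : ∀ c → 1 * (c + 1) ≡ (1 + c) * 1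
  base = solve-∀
bernoulli c (suc k) = begin
  c * c ^ k * (c + suc (suc k))                       ≡⟨ expand c (c ^ k) k ⟩
  c * (c ^ k * (c + suc k)) + c ^ k * c               ≤⟨ +-monoʳ-≤ (c * (c ^ k * (c + suc k))) (*-monoʳ-≤ (c ^ k) (m≤m+n c (suc k))) ⟩
  c * (c ^ k * (c + suc k)) + c ^ k * (c + suc k)     ≡⟨ +-comm (c * (c ^ k * (c + suc k))) _ ⟩
  suc c * (c ^ k * (c + suc k))                       ≤⟨ *-monoʳ-≤ (suc c) (bernoulli c k) ⟩
  suc c * suc c ^ suc k                               ∎
  where
  open ≤-Reasoning
  expand : ∀ c p k → c * p * (c + suc (suc k)) ≡ c * (p * (c + suc k)) + p * c
  expand = solve-∀

sℕ : ℕ → ℕ → ℕ → ℕ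
sℕ ℓ c zero = 0
sℕ ℓ c (suc zero) = 1
sℕ ℓ c (suc (suc n)) = ℓ * sℕ ℓ c (suc n) + c * sℕ ℓ c n

s≡sℕ : ∀ ℓ c n → s (+ ℓ) (+ c) n ≡ + sℕ ℓ c n
s≡sℕ ℓ c zero = refl
s≡sℕ ℓ c (suc zero) = refl
s≡sℕ ℓ c (suc (suc n)) = begin
  + ℓ ℤ.* s (+ ℓ) (+ c) (suc n) ℤ.+ + c ℤ.* s (+ ℓ) (+ c) n
    ≡⟨ cong₂ (λ x y → + ℓ ℤ.* x ℤ.+ + c ℤ.* y) (s≡sℕ ℓ c (suc n)) (s≡sℕ ℓ c n) ⟩
  + ℓ ℤ.* + sℕ ℓ c (suc n) ℤ.+ + c ℤ.* + sℕ ℓ c n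
    ≡⟨ +-linear ℓ (sℕ ℓ c (suc n)) c (sℕ ℓ c n) ⟩
  + sℕ ℓ c (suc (suc n)) ∎
  where open ≡-Reasoning

module PositiveCoefficient (ℓ c : ℕ) (1≤ℓ : 1 ≤ ℓ) where

  private
    u : ℕ → ℕ
    u = sℕ ℓ c

    instance
      ℓ-nonZero : NonZero ℓ
      ℓ-nonZero = >-nonZero 1≤ℓ

  u-mono : ∀ n → u (suc n) ≤ u (suc (suc n))
  u-mono n = ≤-trans (m≤n*m (u (suc n)) ℓ) (m≤m+n (ℓ * u (suc n)) (c * u n))

  product-bound : ∀ n → suc c ^ n ≤ u (suc n) * u (suc (suc n))
  product-bound zero = subst (1 ≤_) (sym (u₁u₂ ℓ c)) 1≤ℓ
    where
    u₁u₂ : ∀ ℓ c → 1 * (ℓ * 1 + c * 0) ≡ ℓ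
    u₁u₂ = solve-∀
  product-bound (suc n) = begin
    suc c * suc c ^ n        ≤⟨ *-monoʳ-≤ (suc c) (product-bound n) ⟩
    x * y + c * (x * y)      ≤⟨ +-monoˡ-≤ (c * (x * y)) (*-monoˡ-≤ y (u-mono n)) ⟩
    y * y + c * (x * y)      ≤⟨ +-monoˡ-≤ (c * (x * y)) (*-monoʳ-≤ y (m≤m*n y ℓ)) ⟩
    y * (y * ℓ) + c * (x * y) ≡⟨ regroup y ℓ c x ⟩
    y * (ℓ * y + c * x)      ∎
    where
    open ≤-Reasoning
    x y : ℕ
    x = u (suc n)
    y = u (suc (suc n))
    regroup : ∀ y ℓ c x → y * (y * ℓ) + c * (x * y) ≡ y * (ℓ * y + c * x)
    regroup = solve-∀

  sℕ-grows : Growth c u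
  sℕ-grows k = begin
    c ^ k * suc k            ≤⟨ *-monoʳ-≤ (c ^ k) (m≤n+m (suc k) c) ⟩
    c ^ k * (c + suc k)      ≤⟨ bernoulli c k ⟩
    suc c ^ suc k            ≤⟨ product-bound (suc k) ⟩
    u (2 + k) * u (3 + k)    ≤⟨ *-monoˡ-≤ (u (3 + k)) (u-mono (suc k)) ⟩
    u (3 + k) * u (3 + k)    ∎
    where open ≤-Reasoning

companion : ℤ → ℤ → ℕ → ℤ
companion L B n = + 2 ℤ.* s L B (suc n) ℤ.- L ℤ.* s L B n

companion-zero : ∀ L B → companion L B 0 ≡ + 2
companion-zero L B = identity L
  where
  identity : ∀ L → + 2 ℤ.* + 1 ℤ.- L ℤ.* + 0 ≡ + 2
  identity = ℤSolver.solve-∀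

cassini : ∀ L B n → s L B (suc n) ℤ.* s L B (suc n) ℤ.- L ℤ.* s L B (suc n) ℤ.* s L B n
                    ℤ.- B ℤ.* s L B n ℤ.* s L B n ≡ (ℤ.- B) ℤ.^ n
cassini L B zero = base L B
  where
  base : ∀ L B → + 1 ℤ.* + 1 ℤ.- L ℤ.* + 1 ℤ.* + 0 ℤ.- B ℤ.* + 0 ℤ.* + 0 ≡ + 1
  base = ℤSolver.solve-∀
cassini L B (suc n) = trans (shift L B (s L B n) (s L B (suc n))) (cong (ℤ.- B ℤ.*_) (cassini L B n))
  where
  shift : ∀ L B x y → (L ℤ.* y ℤ.+ B ℤ.* x) ℤ.* (L ℤ.* y ℤ.+ B ℤ.* x) ℤ.- L ℤ.* (L ℤ.* y ℤ.+ B ℤ.* x) ℤ.* y ℤ.- B ℤ.* y ℤ.* y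
                    ≡ ℤ.- B ℤ.* (y ℤ.* y ℤ.- L ℤ.* y ℤ.* x ℤ.- B ℤ.* x ℤ.* x)
  shift = ℤSolver.solve-∀

s-step : ∀ L B n → + 2 ℤ.* s L B (suc n) ≡ L ℤ.* s L B n ℤ.+ companion L B n
s-step L B n = identity L (s L B n) (s L B (suc n))
  where
  identity : ∀ L x y → + 2 ℤ.* y ≡ L ℤ.* x ℤ.+ (+ 2 ℤ.* y ℤ.- L ℤ.* x)
  identity = ℤSolver.solve-∀

companion-step : ∀ L B n → + 2 ℤ.* companion L B (suc n)
                         ≡ (L ℤ.* L ℤ.+ + 4 ℤ.* B) ℤ.* s L B n ℤ.+ L ℤ.* companion L B n
companion-step L B n = identity L B (s L B n) (s L B (suc n))
  where
  identity : ∀ L B x y → + 2 ℤ.* (+ 2 ℤ.* (L ℤ.* y ℤ.+ B ℤ.* x) ℤ.- L ℤ.* y)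
                         ≡ (L ℤ.* L ℤ.+ + 4 ℤ.* B) ℤ.* x ℤ.+ L ℤ.* (+ 2 ℤ.* y ℤ.- L ℤ.* x)
  identity = ℤSolver.solve-∀

companion-square : ∀ L B n → companion L B n ℤ.* companion L B n
                           ≡ (L ℤ.* L ℤ.+ + 4 ℤ.* B) ℤ.* (s L B n ℤ.* s L B n) ℤ.+ + 4 ℤ.* (ℤ.- B) ℤ.^ n
companion-square L B n = trans (identity L B (s L B n) (s L B (suc n)))
                               (cong (λ z → (L ℤ.* L ℤ.+ + 4 ℤ.* B) ℤ.* (s L B n ℤ.* s L B n) ℤ.+ + 4 ℤ.* z) (cassini L B n))
  where
  identity : ∀ L B x y → (+ 2 ℤ.* y ℤ.- L ℤ.* x) ℤ.* (+ 2 ℤ.* y ℤ.- L ℤ.* x)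
             ≡ (L ℤ.* L ℤ.+ + 4 ℤ.* B) ℤ.* (x ℤ.* x) ℤ.+ + 4 ℤ.* (y ℤ.* y ℤ.- L ℤ.* y ℤ.* x ℤ.- B ℤ.* x ℤ.* x)
  identity = ℤSolver.solve-∀

halve : ∀ x m → + 2 ℤ.* x ≡ + m → Σ ℕ (λ k → x ≡ + k)
halve (+ k) m _ = k , refl
halve -[1+ k ] m ()

-- For b = −c with nonnegative discriminant ℓ² − 4c = Δ, the sequences s and
-- e take natural values: 2 s_{n+1} = ℓ s_n + e_n and 2 e_{n+1} = Δ s_n + ℓ e_n
-- keep both nonnegative.
module NonnegativeDiscriminant (ℓ c : ℕ) (disc≥0 : + 0 ℤ.≤ + ℓ ℤ.* + ℓ ℤ.+ + 4 ℤ.* ℤ.- (+ c)) where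

  private
    L B : ℤ
    L = + ℓ
    B = ℤ.- (+ c)

    Δ : ℕ
    Δ = ℤ.∣ L ℤ.* L ℤ.+ + 4 ℤ.* B ∣

    disc≡Δ : L ℤ.* L ℤ.+ + 4 ℤ.* B ≡ + Δ
    disc≡Δ = sym (ℤP.0≤i⇒+∣i∣≡i disc≥0)

    natural : ∀ n → Σ ℕ (λ p → s L B n ≡ + p) × Σ ℕ (λ q → companion L B n ≡ + q)
    natural zero = (0 , refl) , (2 , companion-zero L B)
    natural (suc n) with natural n
    ... | (p , s≡p) , (q , e≡q) = halve (s L B (suc n)) (ℓ * p + 1 * q) twice-s ,
                                  halve (companion L B (suc n)) (Δ * p + ℓ * q) twice-e
      where
      open ≡-Reasoning
      twice-s : + 2 ℤ.* s L B (suc n) ≡ + (ℓ * p + 1 * q)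
      twice-s = begin
        + 2 ℤ.* s L B (suc n)              ≡⟨ s-step L B n ⟩
        L ℤ.* s L B n ℤ.+ companion L B n  ≡⟨ cong₂ (λ x y → L ℤ.* x ℤ.+ y) s≡p (trans e≡q (sym (ℤP.*-identityˡ (+ q)))) ⟩
        L ℤ.* + p ℤ.+ + 1 ℤ.* + q          ≡⟨ +-linear ℓ p 1 q ⟩
        + (ℓ * p + 1 * q)                  ∎
      twice-e : + 2 ℤ.* companion L B (suc n) ≡ + (Δ * p + ℓ * q)
      twice-e = begin
        + 2 ℤ.* companion L B (suc n)                                   ≡⟨ companion-step L B n ⟩
        (L ℤ.* L ℤ.+ + 4 ℤ.* B) ℤ.* s L B n ℤ.+ L ℤ.* companion L B n  ≡⟨ cong₂ (λ z x → z ℤ.* x ℤ.+ L ℤ.* companion L B n) disc≡Δ s≡p ⟩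
        + Δ ℤ.* + p ℤ.+ L ℤ.* companion L B n                           ≡⟨ cong (λ y → + Δ ℤ.* + p ℤ.+ L ℤ.* y) e≡q ⟩
        + Δ ℤ.* + p ℤ.+ L ℤ.* + q                                       ≡⟨ +-linear Δ p ℓ q ⟩
        + (Δ * p + ℓ * q)                                               ∎

    nat-is-abs : ∀ {x k} → x ≡ + k → x ≡ + ℤ.∣ x ∣
    nat-is-abs refl = refl

  S E : ℕ → ℕ
  S n = ℤ.∣ s L B n ∣
  E n = ℤ.∣ companion L B n ∣

  s≡S : ∀ n → s L B n ≡ + S n
  s≡S n = nat-is-abs (proj₂ (proj₁ (natural n)))

  e≡E : ∀ n → companion L B n ≡ + E n
  e≡E n = nat-is-abs (proj₂ (proj₂ (natural n)))

  S-step : ∀ n → 2 * S (suc n) ≡ ℓ * S n + E n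
  S-step n = ℤP.+-injective (begin
    + (2 * S (suc n))                 ≡⟨ ℤP.pos-* 2 (S (suc n)) ⟩
    + 2 ℤ.* + S (suc n)               ≡⟨ cong (+ 2 ℤ.*_) (sym (s≡S (suc n))) ⟩
    + 2 ℤ.* s L B (suc n)             ≡⟨ s-step L B n ⟩
    L ℤ.* s L B n ℤ.+ companion L B n ≡⟨ cong₂ (λ x y → L ℤ.* x ℤ.+ y) (s≡S n) (e≡E n) ⟩
    L ℤ.* + S n ℤ.+ + E n             ≡⟨ cong (ℤ._+ + E n) (sym (ℤP.pos-* ℓ (S n))) ⟩
    + (ℓ * S n) ℤ.+ + E n             ≡⟨ sym (ℤP.pos-+ (ℓ * S n) (E n)) ⟩
    + (ℓ * S n + E n)                 ∎)
    where open ≡-Reasoning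

  E-bound : ∀ n → 4 * c ^ n ≤ E n * E n
  E-bound n = subst (4 * c ^ n ≤_) (sym E²≡) (m≤n+m (4 * c ^ n) (Δ * (S n * S n)))
    where
    open ≡-Reasoning
    E²≡ : E n * E n ≡ Δ * (S n * S n) + 4 * c ^ n
    E²≡ = ℤP.+-injective (begin
      + (E n * E n)                                          ≡⟨ ℤP.pos-* (E n) (E n) ⟩
      + E n ℤ.* + E n                                        ≡⟨ cong (λ x → x ℤ.* x) (sym (e≡E n)) ⟩
      companion L B n ℤ.* companion L B n                    ≡⟨ companion-square L B n ⟩
      (L ℤ.* L ℤ.+ + 4 ℤ.* B) ℤ.* (s L B n ℤ.* s L B n) ℤ.+ + 4 ℤ.* (ℤ.- B) ℤ.^ n
        ≡⟨ cong₂ (λ z x → z ℤ.* (x ℤ.* x) ℤ.+ + 4 ℤ.* (ℤ.- B) ℤ.^ n) disc≡Δ (s≡S n) ⟩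
      + Δ ℤ.* (+ S n ℤ.* + S n) ℤ.+ + 4 ℤ.* (ℤ.- B) ℤ.^ n
        ≡⟨ cong (λ z → + Δ ℤ.* (+ S n ℤ.* + S n) ℤ.+ + 4 ℤ.* z ℤ.^ n) (ℤP.neg-involutive (+ c)) ⟩
      + Δ ℤ.* (+ S n ℤ.* + S n) ℤ.+ + 4 ℤ.* (+ c) ℤ.^ n
        ≡⟨ cong₂ (λ x y → + Δ ℤ.* x ℤ.+ + 4 ℤ.* y) (sym (ℤP.pos-* (S n) (S n))) (+-^ c n) ⟩
      + Δ ℤ.* + (S n * S n) ℤ.+ + 4 ℤ.* + (c ^ n)            ≡⟨ +-linear Δ (S n * S n) 4 (c ^ n) ⟩
      + (Δ * (S n * S n) + 4 * c ^ n)                        ∎)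

  4c≤ℓ² : 4 * c ≤ ℓ * ℓ
  4c≤ℓ² = subst (4 * c ≤_) (sym ℓ²≡) (m≤n+m (4 * c) Δ)
    where
    open ≡-Reasoning
    split : ∀ L C → L ℤ.* L ≡ (L ℤ.* L ℤ.+ + 4 ℤ.* ℤ.- C) ℤ.+ + 4 ℤ.* C
    split = ℤSolver.solve-∀
    ℓ²≡ : ℓ * ℓ ≡ Δ + 4 * c
    ℓ²≡ = ℤP.+-injective (begin
      + (ℓ * ℓ)                       ≡⟨ ℤP.pos-* ℓ ℓ ⟩
      L ℤ.* L                         ≡⟨ split L (+ c) ⟩
      (L ℤ.* L ℤ.+ + 4 ℤ.* B) ℤ.+ + 4 ℤ.* + c ≡⟨ cong₂ ℤ._+_ disc≡Δ (sym (ℤP.pos-* 4 c)) ⟩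
      + Δ ℤ.+ + (4 * c)               ≡⟨ sym (ℤP.pos-+ Δ (4 * c)) ⟩
      + (Δ + 4 * c)                   ∎)

-- If 2 S_{n+1} = ℓ S_n + E_n with
-- 4c ≤ ℓ², 4cⁿ ≤ E_n², then n² cⁿ ≤ c S_n²: the bound grows
-- like the extremal case s_n = n (ℓ/2)^{n-1}.
module CompanionGrowth (ℓ c : ℕ) .{{_ : NonZero c}} (S E : ℕ → ℕ)
                       (4c≤ℓ² : 4 * c ≤ ℓ * ℓ)
                       (S-step : ∀ n → 2 * S (suc n) ≡ ℓ * S n + E n)
                       (E-bound : ∀ n → 4 * c ^ n ≤ E n * E n) where

  square-growth : ∀ n → n * n * c ^ n ≤ c * (S n * S n)
  square-growth zero = z≤n
  square-growth (suc n) = *-cancelˡ-≤ 4 (begin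
    4 * (suc n * suc n * (c * K))
      ≡⟨ expand c n K ⟩
    4 * c * (n * n * K) + 2 * c * (4 * n * K) + c * (4 * K)
      ≤⟨ +-mono-≤ (+-mono-≤ (*-mono-≤ 4c≤ℓ² ih) (*-monoʳ-≤ (2 * c) cross-term)) (*-monoʳ-≤ c (E-bound n)) ⟩
    ℓ * ℓ * (c * (x * x)) + 2 * c * (ℓ * x * e) + c * (e * e)
      ≡⟨ complete-square ℓ c x e ⟩
    c * ((ℓ * x + e) * (ℓ * x + e))
      ≡⟨ cong (λ z → c * (z * z)) (sym (S-step n)) ⟩
    c * (2 * S (suc n) * (2 * S (suc n)))
      ≡⟨ pull-4 c (S (suc n)) ⟩
    4 * (c * (S (suc n) * S (suc n))) ∎)
    where
    open ≤-Reasoning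
    ih : n * n * c ^ n ≤ c * (S n * S n)
    ih = square-growth n
    x e K : ℕ
    x = S n
    e = E n
    K = c ^ n
    -- The cross term: (4nK)² c ≤ ℓ² (c x²) e², then take square roots.
    cross-term : 4 * n * K ≤ ℓ * x * e
    cross-term = square-≤⇒≤ _ _ (*-cancelˡ-≤ c (begin
      c * (4 * n * K * (4 * n * K))   ≡⟨ regroup c n K ⟩
      4 * c * (n * n * K) * (4 * K)   ≤⟨ *-mono-≤ (*-mono-≤ 4c≤ℓ² ih) (E-bound n) ⟩
      ℓ * ℓ * (c * (x * x)) * (e * e) ≡⟨ regroup′ ℓ c x e ⟩
      c * (ℓ * x * e * (ℓ * x * e))   ∎))
      where
      regroup : ∀ c n K → c * (4 * n * K * (4 * n * K)) ≡ 4 * c * (n * n * K) * (4 * K)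
      regroup = solve-∀
      regroup′ : ∀ ℓ c x e → ℓ * ℓ * (c * (x * x)) * (e * e) ≡ c * (ℓ * x * e * (ℓ * x * e))
      regroup′ = solve-∀
    expand : ∀ c n K → 4 * (suc n * suc n * (c * K)) ≡ 4 * c * (n * n * K) + 2 * c * (4 * n * K) + c * (4 * K)
    expand = solve-∀
    complete-square : ∀ ℓ c x e → ℓ * ℓ * (c * (x * x)) + 2 * c * (ℓ * x * e) + c * (e * e) ≡ c * ((ℓ * x + e) * (ℓ * x + e))
    complete-square = solve-∀
    pull-4 : ∀ c y → c * (2 * y * (2 * y)) ≡ 4 * (c * (y * y))
    pull-4 = solve-∀

  companion-grows : Growth c S
  companion-grows k = *-cancelˡ-≤ c (begin
    c * (c ^ k * suc k)                  ≤⟨ *-monoʳ-≤ c (*-mono-≤ (^-monoʳ-≤ c (m≤n+m k 2)) (≤-trans (m≤n+m (suc k) 2) (m≤m*n (3 + k) (3 + k)))) ⟩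
    c * (c ^ (2 + k) * ((3 + k) * (3 + k))) ≡⟨ regroup c (c ^ (2 + k)) (3 + k) ⟩
    (3 + k) * (3 + k) * c ^ (3 + k)      ≤⟨ square-growth (3 + k) ⟩
    c * (S (3 + k) * S (3 + k))          ∎)
    where
    open ≤-Reasoning
    regroup : ∀ c p m → c * (p * (m * m)) ≡ m * m * (c * p)
    regroup = solve-∀

s-grows : ∀ ℓ b → 0 < ℓ → b ≢ + 0 → + 0 ℤ.≤ + ℓ ℤ.* + ℓ ℤ.+ + 4 ℤ.* b →
          Σ (ℕ → ℕ) (λ S → (∀ n → s (+ ℓ) b n ≡ + S n) × Growth ℤ.∣ b ∣ S)
s-grows ℓ (+ zero) _ b≢0 _ = contradiction refl b≢0
s-grows ℓ (+ suc c) 0<ℓ _ _ = sℕ ℓ (suc c) , s≡sℕ ℓ (suc c) , PositiveCoefficient.sℕ-grows ℓ (suc c) 0<ℓ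
s-grows ℓ -[1+ c ] _ _ disc≥0 = S , s≡S , CompanionGrowth.companion-grows ℓ (suc c) S E 4c≤ℓ² S-step E-bound
  where open NonnegativeDiscriminant ℓ (suc c) disc≥0

numerator-dominates : ∀ c .{{_ : NonZero c}} S p D k → Growth c S →
                      D * D ≤ c ^ (3 + k) → p * p * (c * (c * c)) ≤ k → p * D < S (3 + k)
numerator-dominates c S p D k S-grows D²≤ p²c³≤k = square-<⇒< (p * D) (S (3 + k)) (begin-strict
  p * D * (p * D)                     ≡⟨ interchange p D ⟩
  p * p * (D * D)                     ≤⟨ *-monoʳ-≤ (p * p) D²≤ ⟩
  p * p * (c * (c * (c * c ^ k)))     ≡⟨ regroup p c (c ^ k) ⟩
  c ^ k * (p * p * (c * (c * c)))     <⟨ *-monoʳ-< (c ^ k) {{m^n≢0 c k}} (s≤s p²c³≤k) ⟩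
  c ^ k * suc k                       ≤⟨ S-grows k ⟩
  S (3 + k) * S (3 + k)               ∎)
  where
  open ≤-Reasoning
  interchange : ∀ p D → p * D * (p * D) ≡ p * p * (D * D)
  interchange = solve-∀
  regroup : ∀ p c K → p * p * (c * (c * (c * K))) ≡ K * (p * p * (c * (c * c)))
  regroup = solve-∀

<÷ : ∀ p q N D → 1 ≤ D → p * D < N → mkℚᵘ (+ p) q ℚᵘ.< (+ N) ÷ D
<÷ p q N (suc d) _ pD<N = *<* (subst₂ ℤ._<_ (ℤP.pos-* p (suc d)) (ℤP.pos-* N (suc q))
                                      (ℤ.+<+ (<-≤-trans pD<N (m≤m*n N (suc q)))))

from-three-plus : ∀ {P : ℕ → Set} N → (∀ k → N ≤ k → P (3 + k)) → ∀ n → 3 + N ≤ n → P n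
from-three-plus N P-above (suc (suc (suc k))) (s≤s (s≤s (s≤s N≤k))) = P-above k N≤k

h-large : ∀ ℓ b → b ≢ + 0 → (S : ℕ → ℕ) → (∀ n → s (+ ℓ) b n ≡ + S n) → Growth ℤ.∣ b ∣ S →
          ∀ p q k → p * p * (ℤ.∣ b ∣ * (ℤ.∣ b ∣ * ℤ.∣ b ∣)) ≤ k → mkℚᵘ (+ p) q ℚᵘ.< h ℓ b (3 + k)
h-large ℓ b b≢0 S s≡S S-grows p q k p²c³≤k =
  subst (λ x → mkℚᵘ (+ p) q ℚᵘ.< x ÷ D) (sym (s≡S (3 + k)))
    (<÷ p q (S (3 + k)) D (den-pos (t ℓ b) (σ ℓ b) (3 + k) 1≤t 1≤σ)
        (numerator-dominates ℤ.∣ b ∣ S p D k S-grows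
           (den²≤^ (t ℓ b) (σ ℓ b) ℤ.∣ b ∣ (3 + k) 1≤t 1≤σ t²σ≤∣b∣) p²c³≤k))
  where
  open ReducedGcd ℓ b b≢0
  instance
    ∣b∣≢0 : NonZero ℤ.∣ b ∣
    ∣b∣≢0 = ∣b∣-nonZero b≢0
  D : ℕ
  D = den ℓ b (3 + k)

lemma3p10 : (ℓ : ℕ) (b : ℤ) → 0 ℕ.< ℓ → b ≢ + 0 →
    + 0 ℤ.≤ (+ ℓ) ℤ.* (+ ℓ) ℤ.+ (+ 4) ℤ.* b →
    (B : ℚᵘ) → 0ℚᵘ ℚᵘ.< B →
    Σ ℕ (λ n₀ → (0 ℕ.< n₀) × ((n : ℕ) → n₀ ℕ.≤ n → B ℚᵘ.< h ℓ b n))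
lemma3p10 ℓ b 0<ℓ b≢0 disc≥0 (mkℚᵘ (+ zero) q) (*<* (ℤ.+<+ ()))
lemma3p10 ℓ b 0<ℓ b≢0 disc≥0 (mkℚᵘ -[1+ _ ] q) (*<* ())
lemma3p10 ℓ b 0<ℓ b≢0 disc≥0 (mkℚᵘ (+ p) q) _ with s-grows ℓ b 0<ℓ b≢0 disc≥0
... | S , s≡S , S-grows = 3 + N , z<s , from-three-plus N (h-large ℓ b b≢0 S s≡S S-grows p q)
  where
  N : ℕ
  N = p * p * (ℤ.∣ b ∣ * (ℤ.∣ b ∣ * ℤ.∣ b ∣))
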